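{- Let $n\geq 1$ and let $M\in\mathbb{Z}^{n\times n}$ be an integral matrix with $\det M\neq 0$. Let $\mathcal{L}$ be a hyper-L of the Cayley digraph $G_M=\mathrm{Cay}(\mathbb{Z}^n/M\mathbb{Z}^n,\{e_1,\ldots,e_n\})$, and let $t\geq 1$ be an integer. Then for any two distinct unit cubes $[x],[y]$ in the dilate $t\mathcal{L}$ we have $x\not\equiv y \pmod{tM}$, i.e. there is no $\lambda\in\mathbb{Z}^n$ with $x-y=tM\lambda$.
   Context: $e_1,\ldots,e_n$ is the canonical basis of $\mathbb{Z}^n$. For $a,b\in\mathbb{Z}^n$ and an integral matrix $A$, $a\equiv b\pmod{A}$ means $a-b=A\lambda$ for some $\lambda\in\mathbb{Z}^n$. For $a=(a_1,\ldots,a_n)\in\mathbb{Z}^n$ the unit cube is $[a]=[a_1,a_1+1)\times\cdots\times[a_n,a_n+1)\subset\mathbb{R}^n$. Inequalities $a\leq b$ between vectors are coordinatewise; $\mathbb{N}=\mathbb{Z}_{\geq 0}$; for $a\in\mathbb{N}^n$, $\nabla(a)=\{[b]: 0\leq b\leq a\}$. For a finite Abelian group $\Gamma$ generated by $\gamma_1,\ldots,\gamma_n$ with $N=|\Gamma|$, let $\phi:\mathbb{N}^n\to\Gamma$, $\phi(a)=a_1\gamma_1+\cdots+a_n\gamma_n$. A hyper-L of $\mathrm{Cay}(\Gamma,\{\gamma_1,\ldots,\gamma_n\})$ is a set $\mathcal{L}=\{[a_0],\ldots,[a_{N-1}]\}$ of $N$ unit cubes with $a_i\in\mathbb{N}^n$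 such that (i) $\{\phi(a):[a]\in\mathcal{L}\}=\Gamma$ and (ii) $[a]\in\mathcal{L}$ implies $\nabla(a)\subset\mathcal{L}$. For $G_M$ the group is $\mathbb{Z}^n/M\mathbb{Z}^n$ (of order $|\det M|$) with generators the classes of $e_1,\ldots,e_n$, so $\phi(a)$ is the class of $a$ modulo $M$. For an integer $t\geq1$ the dilate of a unit cube is the set of unit cubes $t[a]=\{[ta+(\alpha_1,\ldots,\alpha_n)]: 0\leq\alpha_1,\ldots,\alpha_n\leq t-1\}$, and the dilate of a hyper-L is $t\mathcal{L}=\bigcup_{[a]\in\mathcal{L}} t[a]$ (a set of unit cubes). -}

module Defs where

open import Data.Nat as ℕ using (ℕ; zero; suc)
open import Data.Integer as ℤ using (ℤ; +_; _-_; _*_; -_)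
open import Data.Fin using (Fin; toℕ)
open import Data.Vec using (Vec; []; _∷_; map; zipWith; foldr′; tabulate; lookup; removeAt)
open import Data.Vec.Relation.Binary.Pointwise.Inductive using (Pointwise)
open import Data.List using (List)
open import Data.Vec.Relation.Unary.All using (All)
open import Data.List.Membership.Propositional using (_∈_)
open import Data.List.Relation.Unary.Unique.Propositional using (Unique)
open import Data.Product using (Σ; ∃; _×_; _,_)
open import Relation.Binary.PropositionalEquality using (_≡_)

ℤVec : ℕ → Set
ℤVec n = Vec ℤ n

Mat : ℕ → Set
Mat n = Vec (Vec ℤ n) n

sumℤ : ∀ {n} → Vec ℤ n → ℤ
sumℤ = foldr′ ℤ._+_ (+ 0)

dot : ∀ {n} → Vec ℤ n → Vec ℤ n → ℤ
dot u v = sumℤ (zipWith _*_ u v)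

_·ᵥ_ : ∀ {n} → Mat n → Vec ℤ n → Vec ℤ n
M ·ᵥ v = map (λ row → dot row v) M

_·ₘ_ : ∀ {n} → ℕ → Mat n → Mat n
t ·ₘ M = map (map (λ x → + t * x)) M

sgn : ℕ → ℤ
sgn zero = + 1
sgn (suc k) = - sgn k

det : ∀ {n} → Mat n → ℤ
det {zero} [] = + 1
det {suc n} (row ∷ rest) =
  sumℤ (tabulate (λ (j : Fin (suc n)) →
    sgn (toℕ j) * lookup row j * det (map (λ r → removeAt r j) rest)))

_≡_[mod_] : ∀ {n} → Vec ℤ n → Vec ℤ n → Mat n → Set
a ≡ b [mod A ] = ∃ λ (λ' : Vec ℤ _) → zipWith _-_ a b ≡ A ·ᵥ λ'

toℤ : ∀ {n} → Vec ℕ n → Vec ℤ n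
toℤ = map +_

_≤ᵥ_ : ∀ {n} → Vec ℕ n → Vec ℕ n → Set
a ≤ᵥ b = Pointwise ℕ._≤_ a b

-- A unit cube [a] with a ∈ ℕ^n is represented by its corner a.
-- A hyper-L of G_M = Cay(ℤ^n / M ℤ^n, {e_1,…,e_n}) is a set of N = |det M|
-- distinct cubes [a], a ∈ ℕ^n, such that (i) φ(L) = Γ, i.e. every class of
-- ℤ^n / Mℤ^n is the class of some corner a, and (ii) L is closed under ∇.
record IsHyperL {n : ℕ} (M : Mat n) (L : List (Vec ℕ n)) : Set where
  field
    distinct    : Unique L
    cardinality : Data.List.length L ≡ ℤ.∣ det M ∣
    surjective  : ∀ (g : Vec ℤ n) → ∃ λ a → a ∈ L × (toℤ a ≡ g [mod M ])
    downClosed  : ∀ {a b : Vec ℕ n} → a ∈ L → b ≤ᵥ a → b ∈ L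

_∈Dilate_ : ∀ {n} → Vec ℕ n → ℕ × List (Vec ℕ n) → Set
_∈Dilate_ {n} x (t , L) =
  ∃ λ (a : Vec ℕ n) → ∃ λ (α : Vec ℕ n) →
    a ∈ L × All (ℕ._< t) α
      × x ≡ zipWith ℕ._+_ (map (t ℕ.*_) a) α

-- Write x = t a + α and y = t b + β with [a], [b] ∈ L and 0 ≤ α, β < t. Since the entries of α − β
-- lie strictly between −t and t, a congruence x ≡ y (mod tM) forces α = β and a ≡ b (mod M), so
-- it suffices that distinct cubes of a hyper-L are incongruent modulo M. The |det M| corners of L
-- meet every class of ℤⁿ/Mℤⁿ, so this follows by pigeonhole once there are |det M| pairwise
-- incongruent vectors. To find them, adding multiples of a column to a neighbouring one (which keeps
-- det M and Mℤⁿ) runs the Euclidean algorithm along the first row until only its last entry g is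
-- nonzero; then the vectors (i, v) with 0 ≤ i < |g| and v from the family for the remaining minor
-- are pairwise incongruent, and there are |g| · |det minor| = |det M| of them.
module Submission where

open import Defs
open import Data.Empty using (⊥)
open import Data.Fin as Fin using (Fin; zero; suc; toℕ; fromℕ; fromℕ<; punchIn; punchOut; remQuot; combine)
import Data.Fin.Properties as Finₚ
open import Data.Integer as ℤ using (ℤ; +_; -[1+_]; _+_; _-_; _*_; -_; _⊖_; ∣_∣)
import Data.Integer.Properties as ℤₚ
open import Algebra.Properties.Semiring.Sum ℤₚ.+-*-semiring
  using (sum; ∑-distrib-+; *-distribˡ-sum; sum-cong-≗; sum-replicate-zero)
open import Data.Integer.Solver using (module +-*-Solver)
open import Data.List as List using (List; []; _∷_; length)
open import Data.List.Membership.Propositional using (_∈_)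
open import Data.List.Relation.Unary.Any using (index)
open import Data.List.Relation.Unary.Any.Properties using (lookup-index)
open import Data.Nat as ℕ using (ℕ; zero; suc; _≤_; _<_; z≤n; s≤s)
import Data.Nat.Properties as ℕₚ
open import Data.Product using (Σ; ∃; _×_; _,_; proj₁; proj₂; uncurry)
open import Data.Sum using (_⊎_; inj₁; inj₂)
open import Data.Vec using (Vec; []; _∷_; map; zipWith; lookup; removeAt; replicate; head; tail; tabulate; _[_]≔_)
import Data.Vec.Properties as Vecₚ
open import Data.Vec.Relation.Unary.All using (All; []; _∷_)
open import Function using (_∘_; const)
open import Relation.Binary.PropositionalEquality
open import Relation.Nullary using (¬_; yes; no; contradiction)

open +-*-Solver

infixl 6 _-ᵥ_
infixr 7 _*ᵥ_

_-ᵥ_ : ∀ {n} → Vec ℤ n → Vec ℤ n → Vec ℤ n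
_-ᵥ_ = zipWith _-_

0ᵥ : ∀ {n} → Vec ℤ n
0ᵥ = replicate _ (+ 0)

_*ᵥ_ : ∀ {m n} → Vec (Vec ℤ n) m → Vec ℤ n → Vec ℤ m
rows *ᵥ v = map (λ row → dot row v) rows

dot-zeroʳ : ∀ {n} (r : Vec ℤ n) → dot r 0ᵥ ≡ + 0
dot-zeroʳ []      = refl
dot-zeroʳ (x ∷ r) rewrite dot-zeroʳ r | ℤₚ.*-zeroʳ x = refl

dot-sub : ∀ {n} (r u v : Vec ℤ n) → dot r (u -ᵥ v) ≡ dot r u - dot r v
dot-sub []      []      []      = refl
dot-sub (x ∷ r) (a ∷ u) (b ∷ v) rewrite dot-sub r u v =
  solve 5 (λ x a b p q → x :* (a :- b) :+ (p :- q) := (x :* a :+ p) :- (x :* b :+ q))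
    refl x a b (dot r u) (dot r v)

dot-scaleˡ : ∀ {n} t (r l : Vec ℤ n) → dot (map (λ x → + t * x) r) l ≡ + t * dot r l
dot-scaleˡ t []      []      = sym (ℤₚ.*-zeroʳ (+ t))
dot-scaleˡ t (x ∷ r) (y ∷ l) rewrite dot-scaleˡ t r l =
  solve 4 (λ t x y d → t :* x :* y :+ t :* d := t :* (x :* y :+ d)) refl (+ t) x y (dot r l)

*ᵥ-zeroʳ : ∀ {m n} (rows : Vec (Vec ℤ n) m) → rows *ᵥ 0ᵥ ≡ 0ᵥ
*ᵥ-zeroʳ []         = refl
*ᵥ-zeroʳ (r ∷ rows) = cong₂ _∷_ (dot-zeroʳ r) (*ᵥ-zeroʳ rows)

*ᵥ-sub : ∀ {m n} (rows : Vec (Vec ℤ n) m) (u v : Vec ℤ n) → rows *ᵥ (u -ᵥ v) ≡ rows *ᵥ u -ᵥ rows *ᵥ v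
*ᵥ-sub []         u v = refl
*ᵥ-sub (r ∷ rows) u v = cong₂ _∷_ (dot-sub r u v) (*ᵥ-sub rows u v)

-ᵥ-self : ∀ {n} (u : Vec ℤ n) → u -ᵥ u ≡ 0ᵥ
-ᵥ-self []      = refl
-ᵥ-self (x ∷ u) = cong₂ _∷_ (ℤₚ.+-inverseʳ x) (-ᵥ-self u)

-ᵥ-via : ∀ {n} (u v w : Vec ℤ n) → u -ᵥ v ≡ (u -ᵥ w) -ᵥ (v -ᵥ w)
-ᵥ-via []      []      []      = refl
-ᵥ-via (a ∷ u) (b ∷ v) (c ∷ w) =
  cong₂ _∷_ (solve 3 (λ a b c → a :- b := (a :- c) :- (b :- c)) refl a b c) (-ᵥ-via u v w)

mod-join : ∀ {n} (M : Mat n) (u v w : Vec ℤ n) → u ≡ w [mod M ] → v ≡ w [mod M ] → u ≡ v [mod M ]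
mod-join M u v w (l , u-w≡Ml) (l′ , v-w≡Ml′) = l -ᵥ l′ , (begin
  u -ᵥ v                   ≡⟨ -ᵥ-via u v w ⟩
  (u -ᵥ w) -ᵥ (v -ᵥ w)     ≡⟨ cong₂ _-ᵥ_ u-w≡Ml v-w≡Ml′ ⟩
  M *ᵥ l -ᵥ M *ᵥ l′        ≡⟨ *ᵥ-sub M l l′ ⟨
  M *ᵥ (l -ᵥ l′)           ∎)
  where open ≡-Reasoning

mod-refl : ∀ {n} (M : Mat n) (u : Vec ℤ n) → u ≡ u [mod M ]
mod-refl M u = 0ᵥ , trans (-ᵥ-self u) (sym (*ᵥ-zeroʳ M))

mod-sym : ∀ {n} (M : Mat n) (u v : Vec ℤ n) → u ≡ v [mod M ] → v ≡ u [mod M ]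
mod-sym M u v u≡v = mod-join M v u v (mod-refl M v) u≡v

mod-trans : ∀ {n} (M : Mat n) (u v w : Vec ℤ n) → u ≡ v [mod M ] → v ≡ w [mod M ] → u ≡ w [mod M ]
mod-trans M u v w u≡v v≡w = mod-join M u w v u≡v (mod-sym M v w v≡w)

IncongruentFamily : ∀ {n} → Mat n → ℕ → Set
IncongruentFamily {n} M N = Σ (Fin N → Vec ℤ n) λ R → ∀ i j → R i ≡ R j [mod M ] → i ≡ j

incongruent-pigeonhole : ∀ {n N K} (M : Mat n) → K < N → ((R , _) : IncongruentFamily M N) →
                         (c : Fin K → Vec ℤ n) → (∀ i → ∃ λ k → c k ≡ R i [mod M ]) → ⊥
incongruent-pigeonhole M K<N (R , R-incongruent) c covered
  with i , j , i<j , fi≡fj ← Finₚ.pigeonhole K<N (proj₁ ∘ covered) =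
  Finₚ.<⇒≢ i<j (R-incongruent i j (mod-join M (R i) (R j) (c (proj₁ (covered j))) Ri≡c Rj≡c))
  where
  Ri≡c = mod-sym M _ _ (subst (λ k → c k ≡ R i [mod M ]) fi≡fj (proj₂ (covered i)))
  Rj≡c = mod-sym M _ _ (proj₂ (covered j))

hyperL-incongruent : ∀ {n} {M : Mat n} {L} → IsHyperL M L → IncongruentFamily M ∣ det M ∣ →
                     ∀ {a b} → a ∈ L → b ∈ L → a ≢ b → ¬ (toℤ a ≡ toℤ b [mod M ])
hyperL-incongruent {L = []} _ _ ()
hyperL-incongruent {n} {M} {L@(_ ∷ xs)} hL family {a} {b} a∈L b∈L a≢b a≡b =
  incongruent-pigeonhole M (ℕₚ.n<1+n (length xs)) family′ (corner ∘ punchIn ib) covered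
  where
  open IsHyperL hL
  family′ = subst (IncongruentFamily M) (sym cardinality) family
  R = proj₁ family′
  corner : Fin (length L) → Vec ℤ n
  corner i = toℤ (List.lookup L i)
  corner-index : ∀ {c} (c∈L : c ∈ L) → corner (index c∈L) ≡ toℤ c
  corner-index c∈L = cong toℤ (sym (lookup-index c∈L))
  ia = index a∈L
  ib = index b∈L
  ib≢ia : ib ≢ ia
  ib≢ia ib≡ia = a≢b (trans (lookup-index a∈L) (trans (cong (List.lookup L) (sym ib≡ia)) (sym (lookup-index b∈L))))
  congruent-corner : ∀ i → ∃ λ j → ib ≢ j × corner j ≡ R i [mod M ]
  congruent-corner i with c , c∈L , c≡Ri ← surjective (R i) with ib Finₚ.≟ index c∈L
  ... | no ib≢c  = index c∈L , ib≢c , subst (_≡ R i [mod M ]) (sym (corner-index c∈L)) c≡Ri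
  ... | yes ib≡c = ia , ib≢ia , subst (_≡ R i [mod M ]) (sym (corner-index a∈L)) (mod-trans M _ _ _ a≡b b≡Ri)
    where
    b≡Ri : toℤ b ≡ R i [mod M ]
    b≡Ri = subst (_≡ R i [mod M ])
             (trans (sym (corner-index c∈L)) (trans (cong corner (sym ib≡c)) (corner-index b∈L))) c≡Ri
  covered : ∀ i → ∃ λ k → corner (punchIn ib k) ≡ R i [mod M ]
  covered i with j , ib≢j , j≡Ri ← congruent-corner i =
    punchOut ib≢j , subst (_≡ R i [mod M ]) (sym (cong corner (Finₚ.punchIn-punchOut ib≢j))) j≡Ri

bounded-diff-multiple : ∀ (g : ℤ) {x y} (z : ℤ) → x < ∣ g ∣ → y < ∣ g ∣ → + x - + y ≡ g * z → z ≡ + 0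
bounded-diff-multiple g {x} {y} z x<g y<g x-y≡gz with z ℤ.≟ + 0
... | yes z≡0 = z≡0
... | no z≢0  = contradiction (ℕₚ.≤-<-trans ∣g∣≤∣x-y∣ ∣x-y∣<∣g∣) (ℕₚ.<-irrefl refl)
  where
  instance _ = ℤ.≢-nonZero z≢0
  ∣x-y∣<∣g∣ : ∣ + x - + y ∣ < ∣ g ∣
  ∣x-y∣<∣g∣ = subst (_< ∣ g ∣) (cong ∣_∣ (sym (ℤₚ.m-n≡m⊖n x y)))
                (ℕₚ.≤-<-trans (ℤₚ.∣m⊝n∣≤m⊔n x y) (ℕₚ.⊔-lub x<g y<g))
  ∣g∣≤∣x-y∣ : ∣ g ∣ ≤ ∣ + x - + y ∣
  ∣g∣≤∣x-y∣ rewrite x-y≡gz | ℤₚ.abs-* g z = ℕₚ.m≤m*n ∣ g ∣ ∣ z ∣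

diff≡0⇒≡ : ∀ {x y} → + x - + y ≡ + 0 → x ≡ y
diff≡0⇒≡ {x} {y} = ℤₚ.+-injective ∘ ℤₚ.i-j≡0⇒i≡j (+ x) (+ y)

dilate : ∀ {n} → ℕ → Vec ℕ n → Vec ℕ n → Vec ℕ n
dilate t a α = zipWith ℕ._+_ (map (t ℕ.*_) a) α

dilate-coordinate : ∀ t {a b α β} (s : ℤ) → α < t → β < t →
                    + (t ℕ.* a ℕ.+ α) - + (t ℕ.* b ℕ.+ β) ≡ + t * s → α ≡ β × + a - + b ≡ s
dilate-coordinate t {a} {b} {α} {β} s α<t β<t eq =
  diff≡0⇒≡ (trans α-β≡t[s-d] (trans (cong (+ t *_) s-d≡0) (ℤₚ.*-zeroʳ (+ t)))) ,
  sym (ℤₚ.i-j≡0⇒i≡j s d s-d≡0)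
  where
  d = + a - + b
  td+α-β≡ts : + t * d + (+ α - + β) ≡ + t * s
  td+α-β≡ts = begin
    + t * d + (+ α - + β)
      ≡⟨ solve 5 (λ t a b α β → t :* (a :- b) :+ (α :- β) := (t :* a :+ α) :- (t :* b :+ β))
           refl (+ t) (+ a) (+ b) (+ α) (+ β) ⟩
    (+ t * + a + + α) - (+ t * + b + + β)
      ≡⟨ cong₂ (λ p q → (p + + α) - (q + + β)) (ℤₚ.pos-* t a) (ℤₚ.pos-* t b) ⟨
    (+ (t ℕ.* a) + + α) - (+ (t ℕ.* b) + + β)
      ≡⟨ cong₂ _-_ (ℤₚ.pos-+ (t ℕ.* a) α) (ℤₚ.pos-+ (t ℕ.* b) β) ⟨
    + (t ℕ.* a ℕ.+ α) - + (t ℕ.* b ℕ.+ β)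
      ≡⟨ eq ⟩
    + t * s
      ∎
    where open ≡-Reasoning
  α-β≡t[s-d] : + α - + β ≡ + t * (s - d)
  α-β≡t[s-d] = begin
    + α - + β
      ≡⟨ solve 3 (λ e t d → e := (t :* d :+ e) :- t :* d) refl (+ α - + β) (+ t) d ⟩
    (+ t * d + (+ α - + β)) - + t * d
      ≡⟨ cong (_- + t * d) td+α-β≡ts ⟩
    + t * s - + t * d
      ≡⟨ solve 3 (λ t s d → t :* s :- t :* d := t :* (s :- d)) refl (+ t) s d ⟩
    + t * (s - d)
      ∎
    where open ≡-Reasoning
  s-d≡0 : s - d ≡ + 0
  s-d≡0 = bounded-diff-multiple (+ t) (s - d) α<t β<t α-β≡t[s-d]

dilate-mod : ∀ {m n} t (rows : Vec (Vec ℤ n) m) (l : Vec ℤ n) {a b α β : Vec ℕ m} →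
             All (_< t) α → All (_< t) β →
             toℤ (dilate t a α) -ᵥ toℤ (dilate t b β) ≡ map (map (λ x → + t * x)) rows *ᵥ l →
             α ≡ β × toℤ a -ᵥ toℤ b ≡ rows *ᵥ l
dilate-mod t [] l {[]} {[]} [] [] eq = refl , refl
dilate-mod t (r ∷ rows) l {_ ∷ _} {_ ∷ _} (α<t ∷ αs<t) (β<t ∷ βs<t) eq
  with eq₀ , eqs ← Vecₚ.∷-injective eq
  with α≡β , a-b≡rl ← dilate-coordinate t (dot r l) α<t β<t (trans eq₀ (dot-scaleˡ t r l))
  with αs≡βs , as-bs≡rowsl ← dilate-mod t rows l αs<t βs<t eqs =
  cong₂ _∷_ α≡β αs≡βs , cong₂ _∷_ a-b≡rl as-bs≡rowsl

removeAt-updateAt : ∀ {A : Set} {n} (r : Vec A (suc n)) c x → removeAt (r [ c ]≔ x) c ≡ removeAt r c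
removeAt-updateAt (y ∷ r)     zero          x = refl
removeAt-updateAt (y ∷ z ∷ r) (suc zero)    x = refl
removeAt-updateAt (y ∷ z ∷ r) (suc (suc c)) x = cong (y ∷_) (removeAt-updateAt (z ∷ r) (suc c) x)

removeAt-updateAt-punchOut : ∀ {A : Set} {n} (r : Vec A (suc n)) c j (j≢c : j ≢ c) x →
                             removeAt (r [ c ]≔ x) j ≡ removeAt r j [ punchOut j≢c ]≔ x
removeAt-updateAt-punchOut (y ∷ r)     zero          zero    j≢c x = contradiction refl j≢c
removeAt-updateAt-punchOut (y ∷ r)     (suc c)       zero    j≢c x = refl
removeAt-updateAt-punchOut (y ∷ z ∷ r) zero          (suc j) j≢c x = refl
removeAt-updateAt-punchOut (y ∷ z ∷ r) (suc zero)    (suc j) j≢c x =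
  cong (y ∷_) (removeAt-updateAt-punchOut (z ∷ r) zero j (j≢c ∘ cong suc) x)
removeAt-updateAt-punchOut (y ∷ z ∷ r) (suc (suc c)) (suc j) j≢c x =
  cong (y ∷_) (removeAt-updateAt-punchOut (z ∷ r) (suc c) j (j≢c ∘ cong suc) x)

Adjacent : ∀ {n} → Fin n → Fin n → Set
Adjacent a b = toℕ b ≡ suc (toℕ a)

Neighbours : ∀ {n} → Fin n → Fin n → Set
Neighbours a b = Adjacent a b ⊎ Adjacent b a

adjacent⇒≢ : ∀ {n} {a b : Fin n} → Adjacent a b → a ≢ b
adjacent⇒≢ b≡1+a refl = ℕₚ.1+n≢n (sym b≡1+a)

neighbours⇒≢ : ∀ {n} {a b : Fin n} → Neighbours a b → a ≢ b
neighbours⇒≢ (inj₁ adj) = adjacent⇒≢ adj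
neighbours⇒≢ (inj₂ adj) = adjacent⇒≢ adj ∘ sym

sgn-neighbours : ∀ {n} {a b : Fin n} → Neighbours a b → sgn (toℕ b) ≡ - sgn (toℕ a)
sgn-neighbours (inj₁ b≡1+a) rewrite b≡1+a = refl
sgn-neighbours {b = b} (inj₂ a≡1+b) rewrite a≡1+b = sym (ℤₚ.neg-involutive (sgn (toℕ b)))

punchOut-adjacent : ∀ {n} (j a b : Fin (suc n)) (j≢a : j ≢ a) (j≢b : j ≢ b) →
                    Adjacent a b → Adjacent (punchOut j≢a) (punchOut j≢b)
punchOut-adjacent zero zero b j≢a j≢b adj = contradiction refl j≢a
punchOut-adjacent zero (suc a) (suc b) j≢a j≢b adj = ℕₚ.suc-injective adj
punchOut-adjacent {suc n} (suc zero) zero (suc zero) j≢a j≢b adj = contradiction refl j≢b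
punchOut-adjacent {suc (suc n)} (suc (suc j)) zero (suc zero) j≢a j≢b adj = refl
punchOut-adjacent {suc n} (suc j) (suc a) (suc b) j≢a j≢b adj =
  cong suc (punchOut-adjacent j a b (j≢a ∘ cong suc) (j≢b ∘ cong suc) (ℕₚ.suc-injective adj))

punchOut-neighbours : ∀ {n} (j a b : Fin (suc n)) (j≢a : j ≢ a) (j≢b : j ≢ b) →
                      Neighbours a b → Neighbours (punchOut j≢a) (punchOut j≢b)
punchOut-neighbours j a b j≢a j≢b (inj₁ adj) = inj₁ (punchOut-adjacent j a b j≢a j≢b adj)
punchOut-neighbours j a b j≢a j≢b (inj₂ adj) = inj₂ (punchOut-adjacent j b a j≢b j≢a adj)

removeAt-adjacent-equal : ∀ {A : Set} {n} (r : Vec A (suc n)) {a b} → Adjacent a b →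
                          lookup r a ≡ lookup r b → removeAt r a ≡ removeAt r b
removeAt-adjacent-equal (x ∷ y ∷ r) {zero}  {suc zero} refl x≡y = cong (_∷ r) (sym x≡y)
removeAt-adjacent-equal (x ∷ y ∷ r) {suc a} {suc b}    adj  eq  =
  cong (x ∷_) (removeAt-adjacent-equal (y ∷ r) (ℕₚ.suc-injective adj) eq)

removeAt-neighbours-equal : ∀ {A : Set} {n} (r : Vec A (suc n)) {a b} → Neighbours a b →
                            lookup r a ≡ lookup r b → removeAt r a ≡ removeAt r b
removeAt-neighbours-equal r (inj₁ adj) eq = removeAt-adjacent-equal r adj eq
removeAt-neighbours-equal r (inj₂ adj) eq = sym (removeAt-adjacent-equal r adj (sym eq))

sumℤ-tabulate : ∀ {n} (f : Fin n → ℤ) → sumℤ (tabulate f) ≡ sum f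
sumℤ-tabulate {zero}  f = refl
sumℤ-tabulate {suc n} f = cong (_+_ (f zero)) (sumℤ-tabulate (f ∘ suc))

sum-+* : ∀ {n} (g h : Fin n → ℤ) k → sum (λ j → g j + k * h j) ≡ sum g + k * sum h
sum-+* g h k = trans (∑-distrib-+ g (λ j → k * h j)) (cong (_+_ (sum g)) (sym (*-distribˡ-sum k h)))

pointMass : ∀ {n} → Fin n → ℤ → Fin n → ℤ
pointMass zero    x zero    = x
pointMass zero    x (suc _) = + 0
pointMass (suc _) x zero    = + 0
pointMass (suc a) x (suc j) = pointMass a x j

pointMass-≡ : ∀ {n} (a : Fin n) x → pointMass a x a ≡ x
pointMass-≡ zero    x = refl
pointMass-≡ (suc a) x = pointMass-≡ a x

pointMass-≢ : ∀ {n} (a j : Fin n) x → j ≢ a → pointMass a x j ≡ + 0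
pointMass-≢ zero    zero    x j≢a = contradiction refl j≢a
pointMass-≢ zero    (suc j) x j≢a = refl
pointMass-≢ (suc a) zero    x j≢a = refl
pointMass-≢ (suc a) (suc j) x j≢a = pointMass-≢ a j x (j≢a ∘ cong suc)

sum-pointMass : ∀ {n} (a : Fin n) x → sum (pointMass a x) ≡ x
sum-pointMass {suc n} zero    x = trans (cong (_+_ x) (sum-replicate-zero n)) (ℤₚ.+-identityʳ x)
sum-pointMass {suc n} (suc a) x = trans (ℤₚ.+-identityˡ _) (sum-pointMass a x)

minor : ∀ {m n} → Vec (Vec ℤ (suc n)) m → Fin (suc n) → Vec (Vec ℤ n) m
minor rows j = map (λ r → removeAt r j) rows

laplaceTerm : ∀ {n} → Vec ℤ (suc n) → Vec (Vec ℤ (suc n)) n → Fin (suc n) → ℤ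
laplaceTerm row rest j = sgn (toℕ j) * lookup row j * det (minor rest j)

det-laplace : ∀ {n} (row : Vec ℤ (suc n)) rest → det (row ∷ rest) ≡ sum (laplaceTerm row rest)
det-laplace row rest = sumℤ-tabulate (laplaceTerm row rest)

setColumn : ∀ {m n} → Vec (Vec ℤ n) m → Fin n → Vec ℤ m → Vec (Vec ℤ n) m
setColumn rows c w = zipWith (λ r x → r [ c ]≔ x) rows w

column : ∀ {m n} → Fin n → Vec (Vec ℤ n) m → Vec ℤ m
column a rows = map (λ r → lookup r a) rows

addMultiple : ∀ {m} → Vec ℤ m → ℤ → Vec ℤ m → Vec ℤ m
addMultiple u k v = zipWith (λ x y → x + k * y) u v

addColumn : ∀ {m n} → Fin n → Fin n → ℤ → Vec (Vec ℤ n) m → Vec (Vec ℤ n) m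
addColumn a b k rows = setColumn rows a (addMultiple (column a rows) k (column b rows))

EqualColumns : ∀ {m n} → Fin n → Fin n → Vec (Vec ℤ n) m → Set
EqualColumns a b rows = All (λ r → lookup r a ≡ lookup r b) rows

minor-setColumn-≡ : ∀ {m n} (rows : Vec (Vec ℤ (suc n)) m) c w → minor (setColumn rows c w) c ≡ minor rows c
minor-setColumn-≡ []         c []      = refl
minor-setColumn-≡ (r ∷ rows) c (x ∷ w) = cong₂ _∷_ (removeAt-updateAt r c x) (minor-setColumn-≡ rows c w)

minor-setColumn-≢ : ∀ {m n} (rows : Vec (Vec ℤ (suc n)) m) c w j (j≢c : j ≢ c) →
                    minor (setColumn rows c w) j ≡ setColumn (minor rows j) (punchOut j≢c) w
minor-setColumn-≢ []         c []      j j≢c = refl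
minor-setColumn-≢ (r ∷ rows) c (x ∷ w) j j≢c =
  cong₂ _∷_ (removeAt-updateAt-punchOut r c j j≢c x) (minor-setColumn-≢ rows c w j j≢c)

minor-equalColumns : ∀ {m n} (rows : Vec (Vec ℤ (suc n)) m) {a b} j (j≢a : j ≢ a) (j≢b : j ≢ b) →
                     EqualColumns a b rows → EqualColumns (punchOut j≢a) (punchOut j≢b) (minor rows j)
minor-equalColumns []         j j≢a j≢b []             = []
minor-equalColumns (r ∷ rows) j j≢a j≢b (ra≡rb ∷ eqs) =
  trans (Vecₚ.removeAt-punchOut r j≢a) (trans ra≡rb (sym (Vecₚ.removeAt-punchOut r j≢b)))
    ∷ minor-equalColumns rows j j≢a j≢b eqs

minor-neighbours-equal : ∀ {m n} (rows : Vec (Vec ℤ (suc n)) m) {a b} → Neighbours a b →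
                         EqualColumns a b rows → minor rows a ≡ minor rows b
minor-neighbours-equal []         nb []             = refl
minor-neighbours-equal (r ∷ rows) nb (ra≡rb ∷ eqs) =
  cong₂ _∷_ (removeAt-neighbours-equal r nb ra≡rb) (minor-neighbours-equal rows nb eqs)

det-setColumn-linear : ∀ {n} (M : Mat n) c (u v : Vec ℤ n) k →
                       det (setColumn M c (addMultiple u k v)) ≡ det (setColumn M c u) + k * det (setColumn M c v)
det-setColumn-linear {suc n} (row ∷ rest) c (u₀ ∷ u) (v₀ ∷ v) k = begin
  det ((row [ c ]≔ (u₀ + k * v₀)) ∷ setColumn rest c (addMultiple u k v))
    ≡⟨ expand (u₀ + k * v₀) (addMultiple u k v) ⟩
  sum (term (u₀ + k * v₀) (addMultiple u k v))
    ≡⟨ sum-cong-≗ termwise ⟩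
  sum (λ j → term u₀ u j + k * term v₀ v j)
    ≡⟨ sum-+* (term u₀ u) (term v₀ v) k ⟩
  sum (term u₀ u) + k * sum (term v₀ v)
    ≡⟨ cong₂ (λ p q → p + k * q) (expand u₀ u) (expand v₀ v) ⟨
  det ((row [ c ]≔ u₀) ∷ setColumn rest c u) + k * det ((row [ c ]≔ v₀) ∷ setColumn rest c v)
    ∎
  where
  open ≡-Reasoning
  term : ℤ → Vec ℤ n → Fin (suc n) → ℤ
  term x w = laplaceTerm (row [ c ]≔ x) (setColumn rest c w)
  expand : ∀ x w → det ((row [ c ]≔ x) ∷ setColumn rest c w) ≡ sum (term x w)
  expand x w = det-laplace (row [ c ]≔ x) (setColumn rest c w)
  termwise : ∀ j → term (u₀ + k * v₀) (addMultiple u k v) j ≡ term u₀ u j + k * term v₀ v j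
  termwise j with j Finₚ.≟ c
  ... | yes refl
    rewrite Vecₚ.lookup∘updateAt j {const (u₀ + k * v₀)} row
          | Vecₚ.lookup∘updateAt j {const u₀} row | Vecₚ.lookup∘updateAt j {const v₀} row
          | minor-setColumn-≡ rest j (addMultiple u k v) | minor-setColumn-≡ rest j u
          | minor-setColumn-≡ rest j v =
    solve 5 (λ s a b k d → s :* (a :+ k :* b) :* d := s :* a :* d :+ k :* (s :* b :* d))
      refl (sgn (toℕ j)) u₀ v₀ k (det (minor rest j))
  ... | no j≢c
    rewrite Vecₚ.lookup∘updateAt′ j c {const (u₀ + k * v₀)} j≢c row
          | Vecₚ.lookup∘updateAt′ j c {const u₀} j≢c row | Vecₚ.lookup∘updateAt′ j c {const v₀} j≢c row
          | minor-setColumn-≢ rest c (addMultiple u k v) j j≢c | minor-setColumn-≢ rest c u j j≢c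
          | minor-setColumn-≢ rest c v j j≢c
          | det-setColumn-linear (minor rest j) (punchOut j≢c) u v k =
    solve 5 (λ s a k d e → s :* a :* (d :+ k :* e) := s :* a :* d :+ k :* (s :* a :* e))
      refl (sgn (toℕ j)) (lookup row j) k
      (det (setColumn (minor rest j) (punchOut j≢c) u))
      (det (setColumn (minor rest j) (punchOut j≢c) v))

-- The minors at a and b coincide only because a and b are neighbours (otherwise their columns differ
-- by a cyclic shift); this is why only neighbouring columns are ever combined.
det-equalColumns : ∀ {n} (M : Mat n) {a b} → Neighbours a b → EqualColumns a b M → det M ≡ + 0
det-equalColumns {suc n} (row ∷ rest) {a} {b} nb (rowa≡rowb ∷ eqs) = begin
  det (row ∷ rest)                                     ≡⟨ det-laplace row rest ⟩
  sum (laplaceTerm row rest)                           ≡⟨ sum-cong-≗ termwise ⟩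
  sum (λ j → pointMass a X j + pointMass b (- X) j)    ≡⟨ ∑-distrib-+ (pointMass a X) (pointMass b (- X)) ⟩
  sum (pointMass a X) + sum (pointMass b (- X))        ≡⟨ cong₂ _+_ (sum-pointMass a X) (sum-pointMass b (- X)) ⟩
  X - X                                                ≡⟨ ℤₚ.+-inverseʳ X ⟩
  + 0                                                  ∎
  where
  open ≡-Reasoning
  X = laplaceTerm row rest a
  a≢b = neighbours⇒≢ nb
  termwise : ∀ j → laplaceTerm row rest j ≡ pointMass a X j + pointMass b (- X) j
  termwise j with j Finₚ.≟ a | j Finₚ.≟ b
  ... | yes refl | _
    rewrite pointMass-≡ j X | pointMass-≢ b j (- X) a≢b = sym (ℤₚ.+-identityʳ X)
  ... | no j≢a | yes refl
    rewrite pointMass-≢ a j X j≢a | pointMass-≡ j (- X) | sgn-neighbours nb | rowa≡rowb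
          | minor-neighbours-equal rest nb eqs =
    trans (solve 3 (λ s x d → (:- s) :* x :* d := :- (s :* x :* d))
             refl (sgn (toℕ a)) (lookup row j) (det (minor rest j)))
          (sym (ℤₚ.+-identityˡ _))
  ... | no j≢a | no j≢b
    rewrite pointMass-≢ a j X j≢a | pointMass-≢ b j (- X) j≢b
          | det-equalColumns (minor rest j) (punchOut-neighbours j a b j≢a j≢b nb)
                                              (minor-equalColumns rest j j≢a j≢b eqs) =
    ℤₚ.*-zeroʳ (sgn (toℕ j) * lookup row j)

setColumn-column : ∀ {m n} (rows : Vec (Vec ℤ n) m) a → setColumn rows a (column a rows) ≡ rows
setColumn-column []         a = refl
setColumn-column (r ∷ rows) a = cong₂ _∷_ (Vecₚ.[]≔-lookup r a) (setColumn-column rows a)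

setColumn-equalColumns : ∀ {m n} (rows : Vec (Vec ℤ n) m) {a b} → b ≢ a →
                         EqualColumns a b (setColumn rows a (column b rows))
setColumn-equalColumns []         b≢a = []
setColumn-equalColumns (r ∷ rows) {a} {b} b≢a =
  trans (Vecₚ.lookup∘updateAt a r) (sym (Vecₚ.lookup∘updateAt′ b a b≢a r)) ∷ setColumn-equalColumns rows b≢a

det-addColumn : ∀ {n} (M : Mat n) {a b} → Neighbours a b → ∀ k → det (addColumn a b k M) ≡ det M
det-addColumn M {a} {b} nb k = begin
  det (addColumn a b k M)
    ≡⟨ det-setColumn-linear M a _ _ k ⟩
  det (setColumn M a (column a M)) + k * det (setColumn M a (column b M))
    ≡⟨ cong₂ (λ p q → p + k * q) (cong det (setColumn-column M a)) det-equal ⟩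
  det M + k * + 0
    ≡⟨ cong (_+_ (det M)) (ℤₚ.*-zeroʳ k) ⟩
  det M + + 0
    ≡⟨ ℤₚ.+-identityʳ (det M) ⟩
  det M
    ∎
  where
  open ≡-Reasoning
  det-equal = det-equalColumns _ nb (setColumn-equalColumns M (neighbours⇒≢ nb ∘ sym))

dot-updateAtˡ : ∀ {n} (u v : Vec ℤ n) c x → dot (u [ c ]≔ x) v ≡ dot u v + (x - lookup u c) * lookup v c
dot-updateAtˡ (u₀ ∷ u) (v₀ ∷ v) zero x =
  solve 4 (λ x v₀ d u₀ → x :* v₀ :+ d := u₀ :* v₀ :+ d :+ (x :- u₀) :* v₀) refl x v₀ (dot u v) u₀
dot-updateAtˡ (u₀ ∷ u) (v₀ ∷ v) (suc c) x rewrite dot-updateAtˡ u v c x =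
  sym (ℤₚ.+-assoc (u₀ * v₀) (dot u v) _)

dot-updateAtʳ : ∀ {n} (u v : Vec ℤ n) c y → dot u (v [ c ]≔ y) ≡ dot u v + lookup u c * (y - lookup v c)
dot-updateAtʳ (u₀ ∷ u) (v₀ ∷ v) zero y =
  solve 4 (λ y v₀ d u₀ → u₀ :* y :+ d := u₀ :* v₀ :+ d :+ u₀ :* (y :- v₀)) refl y v₀ (dot u v) u₀
dot-updateAtʳ (u₀ ∷ u) (v₀ ∷ v) (suc c) y rewrite dot-updateAtʳ u v c y =
  sym (ℤₚ.+-assoc (u₀ * v₀) (dot u v) _)

dot-addColumn : ∀ {n} (r l : Vec ℤ n) {a b} → b ≢ a → ∀ k →
                dot (r [ a ]≔ (lookup r a + k * lookup r b)) (l [ b ]≔ (lookup l b - k * lookup l a)) ≡ dot r l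
dot-addColumn r l {a} {b} b≢a k
  rewrite dot-updateAtʳ (r [ a ]≔ (lookup r a + k * lookup r b)) l b (lookup l b - k * lookup l a)
        | dot-updateAtˡ r l a (lookup r a + k * lookup r b)
        | Vecₚ.lookup∘updateAt′ b a {const (lookup r a + k * lookup r b)} b≢a r =
  solve 6 (λ d ra rb la lb k → d :+ (ra :+ k :* rb :- ra) :* la :+ rb :* (lb :- k :* la :- lb) := d) refl
    (dot r l) (lookup r a) (lookup r b) (lookup l a) (lookup l b) k

addColumn-*ᵥ : ∀ {m n} (rows : Vec (Vec ℤ n) m) (l : Vec ℤ n) {a b} → b ≢ a → ∀ k →
               addColumn a b k rows *ᵥ (l [ b ]≔ (lookup l b - k * lookup l a)) ≡ rows *ᵥ l
addColumn-*ᵥ []         l b≢a k = refl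
addColumn-*ᵥ (r ∷ rows) l b≢a k = cong₂ _∷_ (dot-addColumn r l b≢a k) (addColumn-*ᵥ rows l b≢a k)

record _⇝_ {n} (M M′ : Mat n) : Set where
  field
    det-≡     : det M′ ≡ det M
    lattice-⊆ : ∀ {w} → ∃ (λ l → w ≡ M *ᵥ l) → ∃ (λ l → w ≡ M′ *ᵥ l)

⇝-refl : ∀ {n} {M : Mat n} → M ⇝ M
⇝-refl = record { det-≡ = refl ; lattice-⊆ = λ w∈M → w∈M }

⇝-trans : ∀ {n} {M M′ M″ : Mat n} → M ⇝ M′ → M′ ⇝ M″ → M ⇝ M″
⇝-trans M⇝M′ M′⇝M″ = record
  { det-≡     = trans (_⇝_.det-≡ M′⇝M″) (_⇝_.det-≡ M⇝M′)
  ; lattice-⊆ = _⇝_.lattice-⊆ M′⇝M″ ∘ _⇝_.lattice-⊆ M⇝M′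
  }

⇝-incongruent : ∀ {n N} {M M′ : Mat n} → M ⇝ M′ → IncongruentFamily M′ N → IncongruentFamily M N
⇝-incongruent M⇝M′ (R , R-incongruent) = R , λ i j Ri≡Rj → R-incongruent i j (_⇝_.lattice-⊆ M⇝M′ Ri≡Rj)

addColumn-⇝ : ∀ {n} (M : Mat n) {a b} → Neighbours a b → ∀ k → M ⇝ addColumn a b k M
addColumn-⇝ M {a} {b} nb k = record
  { det-≡     = det-addColumn M nb k
  ; lattice-⊆ = λ { (l , w≡Ml) →
      l [ b ]≔ (lookup l b - k * lookup l a) , trans w≡Ml (sym (addColumn-*ᵥ M l (neighbours⇒≢ nb ∘ sym) k)) }
  }

∣⊖∣<ʳ : ∀ {p q} → 0 < q → q ≤ p → ∣ q ⊖ p ∣ < p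
∣⊖∣<ʳ {p} {q} 0<q q≤p rewrite ℤₚ.∣⊖∣-≤ q≤p = ℕₚ.∸-monoʳ-< 0<q q≤p

∣⊖∣<ˡ : ∀ {p q} → 0 < q → q ≤ p → ∣ p ⊖ q ∣ < p
∣⊖∣<ˡ {p} {q} 0<q q≤p rewrite ℤₚ.∣m⊖n∣≡∣n⊖m∣ p q = ∣⊖∣<ʳ 0<q q≤p

-- One step of the Euclidean algorithm; since ∣ y ∣ ≤ ∣ x ∣, some k = ±1 works.
abs-decrease : ∀ x y → y ≢ + 0 → ∣ y ∣ ≤ ∣ x ∣ → ∃ λ k → ∣ x + k * y ∣ < ∣ x ∣
abs-decrease x        (+ zero)  y≢0 y≤x = contradiction refl y≢0
abs-decrease (+ p)    (+ suc q) y≢0 y≤x = -[1+ 0 ] ,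
  subst (λ z → ∣ p ⊖ suc z ∣ < p) (sym (ℕₚ.+-identityʳ q)) (∣⊖∣<ˡ (s≤s z≤n) y≤x)
abs-decrease (+ p)    -[1+ q ]  y≢0 y≤x = + 1 ,
  subst (λ z → ∣ p ⊖ suc z ∣ < p) (sym (ℕₚ.+-identityʳ q)) (∣⊖∣<ˡ (s≤s z≤n) y≤x)
abs-decrease -[1+ p ] (+ suc q) y≢0 y≤x = + 1 ,
  subst (λ z → ∣ suc z ⊖ suc p ∣ < suc p) (sym (ℕₚ.+-identityʳ q)) (∣⊖∣<ʳ (s≤s z≤n) y≤x)
abs-decrease -[1+ p ] -[1+ q ]  y≢0 y≤x = -[1+ 0 ] ,
  subst (λ z → ∣ suc z ⊖ suc p ∣ < suc p) (sym (ℕₚ.+-identityʳ q)) (∣⊖∣<ʳ (s≤s z≤n) y≤x)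

Cleared : ∀ {m} → Mat (suc m) → Fin (suc m) → Fin (suc m) → Set
Cleared M a b = ∃ λ M′ → M ⇝ M′ × lookup (head M′) a ≡ + 0
                  × (∀ j → j ≢ a → j ≢ b → lookup (head M′) j ≡ lookup (head M) j)

cleared-here : ∀ {m} {M : Mat (suc m)} {a b} → lookup (head M) a ≡ + 0 → Cleared M a b
cleared-here {M = M} Ma≡0 = M , ⇝-refl , Ma≡0 , λ _ _ _ → refl

cleared-after : ∀ {m} {M M₁ : Mat (suc m)} {a b} → M ⇝ M₁ →
                (∀ j → j ≢ a → j ≢ b → lookup (head M₁) j ≡ lookup (head M) j) → Cleared M₁ a b → Cleared M a b
cleared-after M⇝M₁ same₁ (M′ , M₁⇝M′ , M′a≡0 , same′) =
  M′ , ⇝-trans M⇝M₁ M₁⇝M′ , M′a≡0 , λ j j≢a j≢b → trans (same′ j j≢a j≢b) (same₁ j j≢a j≢b)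

addColumn-head-≡ : ∀ {m n} (row : Vec ℤ n) (rest : Vec (Vec ℤ n) m) a b k →
                   lookup (head (addColumn a b k (row ∷ rest))) a ≡ lookup row a + k * lookup row b
addColumn-head-≡ row rest a b k = Vecₚ.lookup∘updateAt a row

addColumn-head-≢ : ∀ {m n} (row : Vec ℤ n) (rest : Vec (Vec ℤ n) m) a b k j → j ≢ a →
                   lookup (head (addColumn a b k (row ∷ rest))) j ≡ lookup row j
addColumn-head-≢ row rest a b k j j≢a = Vecₚ.lookup∘updateAt′ j a j≢a row

clearEntry : ∀ {m} fuel (M : Mat (suc m)) {a b} → Adjacent a b →
             ∣ lookup (head M) a ∣ ℕ.+ ∣ lookup (head M) b ∣ < fuel → Cleared M a b
clearEntry zero       M                    adj ()
clearEntry (suc fuel) M@(row ∷ rest) {a} {b} adj bound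
  with lookup row a ℤ.≟ + 0 | lookup row b ℤ.≟ + 0
... | yes x≡0 | _ = cleared-here x≡0
... | no x≢0 | yes y≡0 =
  -- (x, 0) ↦ (x, x) ↦ (0, x): recursing after the first step would need more fuel.
  cleared-after (addColumn-⇝ M (inj₂ adj) (+ 1)) (λ j _ j≢b → addColumn-head-≢ row rest b a (+ 1) j j≢b)
    (cleared-after (addColumn-⇝ M₁ (inj₁ adj) -[1+ 0 ]) (λ j j≢a _ → addColumn-head-≢ row₁ rest₁ a b -[1+ 0 ] j j≢a)
      (cleared-here a-cleared))
  where
  M₁ = addColumn b a (+ 1) M
  row₁ = head M₁
  rest₁ = tail M₁
  a-cleared : lookup (head (addColumn a b -[1+ 0 ] M₁)) a ≡ + 0
  a-cleared
    rewrite addColumn-head-≡ row₁ rest₁ a b -[1+ 0 ] | addColumn-head-≢ row rest b a (+ 1) a (adjacent⇒≢ adj)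
          | addColumn-head-≡ row rest b a (+ 1) | y≡0 =
    solve 1 (λ x → x :+ con -[1+ 0 ] :* (con (+ 0) :+ con (+ 1) :* x) := con (+ 0)) refl (lookup row a)
... | no x≢0 | no y≢0 with ∣ lookup row b ∣ ℕₚ.≤? ∣ lookup row a ∣
...   | yes y≤x with k , smaller ← abs-decrease (lookup row a) (lookup row b) y≢0 y≤x =
  cleared-after (addColumn-⇝ M (inj₁ adj) k) (λ j j≢a _ → addColumn-head-≢ row rest a b k j j≢a)
    (clearEntry fuel (addColumn a b k M) adj bound′)
  where
  bound′ : ∣ lookup (head (addColumn a b k M)) a ∣ ℕ.+ ∣ lookup (head (addColumn a b k M)) b ∣ < fuel
  bound′ rewrite addColumn-head-≡ row rest a b k | addColumn-head-≢ row rest a b k b (adjacent⇒≢ adj ∘ sym) =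
    ℕₚ.<-≤-trans (ℕₚ.+-monoˡ-< _ smaller) (ℕₚ.≤-pred bound)
...   | no y≰x with k , smaller ← abs-decrease (lookup row b) (lookup row a) x≢0 (ℕₚ.<⇒≤ (ℕₚ.≰⇒> y≰x)) =
  cleared-after (addColumn-⇝ M (inj₂ adj) k) (λ j _ j≢b → addColumn-head-≢ row rest b a k j j≢b)
    (clearEntry fuel (addColumn b a k M) adj bound′)
  where
  bound′ : ∣ lookup (head (addColumn b a k M)) a ∣ ℕ.+ ∣ lookup (head (addColumn b a k M)) b ∣ < fuel
  bound′ rewrite addColumn-head-≡ row rest b a k | addColumn-head-≢ row rest b a k a (adjacent⇒≢ adj) =
    ℕₚ.<-≤-trans (ℕₚ.+-monoʳ-< ∣ lookup row a ∣ smaller) (ℕₚ.≤-pred bound)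

ZeroPrefix : ∀ {m} → ℕ → Mat (suc m) → Set
ZeroPrefix k M = ∀ j → toℕ j < k → lookup (head M) j ≡ + 0

fromℕ<-adjacent : ∀ {m k} (k<m : k < m) → Adjacent (fromℕ< (s≤s (ℕₚ.<⇒≤ k<m))) (fromℕ< {suc k} {suc m} (s≤s k<m))
fromℕ<-adjacent k<m = trans (Finₚ.toℕ-fromℕ< (s≤s k<m)) (cong suc (sym (Finₚ.toℕ-fromℕ< (s≤s (ℕₚ.<⇒≤ k<m)))))

clearPrefix : ∀ {m} k → k ≤ m → (M : Mat (suc m)) → ∃ λ M′ → M ⇝ M′ × ZeroPrefix k M′
clearPrefix zero    _   M = M , ⇝-refl , λ j ()
clearPrefix {m} (suc k) k<m M
  with M₁ , M⇝M₁ , zeros₁ ← clearPrefix k (ℕₚ.<⇒≤ k<m) M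
  with M′ , M₁⇝M′ , M′a≡0 , same′ ← clearEntry _ M₁ (fromℕ<-adjacent k<m) (ℕₚ.n<1+n _) =
  M′ , ⇝-trans M⇝M₁ M₁⇝M′ , zeros′
  where
  a≡k : toℕ (fromℕ< (s≤s (ℕₚ.<⇒≤ k<m))) ≡ k
  a≡k = Finₚ.toℕ-fromℕ< (s≤s (ℕₚ.<⇒≤ k<m))
  zeros′ : ZeroPrefix (suc k) M′
  zeros′ j j<1+k with toℕ j ℕₚ.≟ k
  ... | yes j≡k = subst (λ i → lookup (head M′) i ≡ + 0) (Finₚ.toℕ-injective (trans a≡k (sym j≡k))) M′a≡0
  ... | no j≢k  = trans (same′ j (λ j≡a → j≢k (trans (cong toℕ j≡a) a≡k)) j≢b) (zeros₁ j j<k)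
    where
    j<k = ℕₚ.≤∧≢⇒< (ℕₚ.≤-pred j<1+k) j≢k
    j≢b : j ≢ fromℕ< (s≤s k<m)
    j≢b j≡b = ℕₚ.<-irrefl (trans (cong toℕ j≡b) (Finₚ.toℕ-fromℕ< (s≤s k<m))) (ℕₚ.<-trans j<k (ℕₚ.n<1+n k))

SingleEntry : ∀ {n} → Vec ℤ n → Fin n → Set
SingleEntry r p = ∀ j → j ≢ p → lookup r j ≡ + 0

dot-removeAt : ∀ {n} (r l : Vec ℤ (suc n)) p → dot r l ≡ dot (removeAt r p) (removeAt l p) + lookup r p * lookup l p
dot-removeAt (x ∷ r)     (y ∷ l)     zero    = ℤₚ.+-comm (x * y) (dot r l)
dot-removeAt (x ∷ x′ ∷ r) (y ∷ y′ ∷ l) (suc p) rewrite dot-removeAt (x′ ∷ r) (y′ ∷ l) p =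
  sym (ℤₚ.+-assoc (x * y) _ _)

dot-zeroˡ : ∀ {n} (r l : Vec ℤ n) → (∀ j → lookup r j ≡ + 0) → dot r l ≡ + 0
dot-zeroˡ []      []      r≡0 = refl
dot-zeroˡ (x ∷ r) (y ∷ l) r≡0 rewrite r≡0 zero | dot-zeroˡ r l (r≡0 ∘ suc) = refl

removeAt-singleEntry : ∀ {n} (r : Vec ℤ (suc n)) p → SingleEntry r p → ∀ i → lookup (removeAt r p) i ≡ + 0
removeAt-singleEntry r p single i = begin
  lookup (removeAt r p) i                  ≡⟨ cong (lookup (removeAt r p)) (Finₚ.punchOut-punchIn p) ⟨
  lookup (removeAt r p) (punchOut p≢pᵢ)    ≡⟨ Vecₚ.removeAt-punchOut r p≢pᵢ ⟩
  lookup r (punchIn p i)                   ≡⟨ single (punchIn p i) (Finₚ.punchInᵢ≢i p i) ⟩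
  + 0                                      ∎
  where
  open ≡-Reasoning
  p≢pᵢ = Finₚ.punchInᵢ≢i p i ∘ sym

dot-singleEntry : ∀ {n} (r l : Vec ℤ (suc n)) p → SingleEntry r p → dot r l ≡ lookup r p * lookup l p
dot-singleEntry r l p single
  rewrite dot-removeAt r l p | dot-zeroˡ (removeAt r p) (removeAt l p) (removeAt-singleEntry r p single) =
  ℤₚ.+-identityˡ _

*ᵥ-removeAt : ∀ {m n} (rows : Vec (Vec ℤ (suc n)) m) (l : Vec ℤ (suc n)) p → lookup l p ≡ + 0 →
              rows *ᵥ l ≡ minor rows p *ᵥ removeAt l p
*ᵥ-removeAt []         l p lp≡0 = refl
*ᵥ-removeAt (r ∷ rows) l p lp≡0 = cong₂ _∷_ rl≡ (*ᵥ-removeAt rows l p lp≡0)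
  where
  rl≡ : dot r l ≡ dot (removeAt r p) (removeAt l p)
  rl≡ rewrite dot-removeAt r l p | lp≡0 | ℤₚ.*-zeroʳ (lookup r p) = ℤₚ.+-identityʳ _

det-singleEntry : ∀ {m} (row : Vec ℤ (suc m)) rest p → SingleEntry row p →
                  det (row ∷ rest) ≡ sgn (toℕ p) * lookup row p * det (minor rest p)
det-singleEntry row rest p single =
  trans (det-laplace row rest) (trans (sum-cong-≗ termwise) (sum-pointMass p (laplaceTerm row rest p)))
  where
  termwise : ∀ j → laplaceTerm row rest j ≡ pointMass p (laplaceTerm row rest p) j
  termwise j with j Finₚ.≟ p
  ... | yes refl = sym (pointMass-≡ j _)
  ... | no j≢p rewrite pointMass-≢ p j (laplaceTerm row rest p) j≢p | single j j≢p
                     | ℤₚ.*-zeroʳ (sgn (toℕ j)) = ℤₚ.*-zeroˡ (det (minor rest j))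

∣sgn*∣ : ∀ k x → ∣ sgn k * x ∣ ≡ ∣ x ∣
∣sgn*∣ zero    x = cong ∣_∣ (ℤₚ.*-identityˡ x)
∣sgn*∣ (suc k) x = trans (cong ∣_∣ (sym (ℤₚ.neg-distribˡ-* (sgn k) x))) (trans (ℤₚ.∣-i∣≡∣i∣ (sgn k * x)) (∣sgn*∣ k x))

incongruent-singleEntry : ∀ {m K} (row : Vec ℤ (suc m)) rest p → SingleEntry row p →
                          IncongruentFamily (minor rest p) K → IncongruentFamily (row ∷ rest) (∣ lookup row p ∣ ℕ.* K)
incongruent-singleEntry {m} {K} row rest p single (R′ , R′-incongruent) = R , R-incongruent
  where
  g = lookup row p
  R : Fin (∣ g ∣ ℕ.* K) → Vec ℤ (suc m)
  R x = + toℕ (proj₁ (remQuot {∣ g ∣} K x)) ∷ R′ (proj₂ (remQuot {∣ g ∣} K x))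
  R-incongruent : ∀ x y → R x ≡ R y [mod row ∷ rest ] → x ≡ y
  R-incongruent x y (l , Rx-Ry≡Ml) = begin
    x                                   ≡⟨ Finₚ.combine-remQuot {∣ g ∣} K x ⟨
    uncurry combine (remQuot {∣ g ∣} K x)       ≡⟨ cong₂ combine (Finₚ.toℕ-injective i≡i′) j≡j′ ⟩
    uncurry combine (remQuot {∣ g ∣} K y)       ≡⟨ Finₚ.combine-remQuot {∣ g ∣} K y ⟩
    y                                   ∎
    where
    open ≡-Reasoning
    i = proj₁ (remQuot {∣ g ∣} K x)
    j = proj₂ (remQuot {∣ g ∣} K x)
    i′ = proj₁ (remQuot {∣ g ∣} K y)
    j′ = proj₂ (remQuot {∣ g ∣} K y)
    i-i′≡g*lp : + toℕ i - + toℕ i′ ≡ g * lookup l p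
    i-i′≡g*lp = trans (proj₁ (Vecₚ.∷-injective Rx-Ry≡Ml)) (dot-singleEntry row l p single)
    lp≡0 = bounded-diff-multiple g (lookup l p) (Finₚ.toℕ<n i) (Finₚ.toℕ<n i′) i-i′≡g*lp
    i≡i′ : toℕ i ≡ toℕ i′
    i≡i′ = diff≡0⇒≡ (trans i-i′≡g*lp (trans (cong (g *_) lp≡0) (ℤₚ.*-zeroʳ g)))
    R′j-R′j′≡ : R′ j -ᵥ R′ j′ ≡ minor rest p *ᵥ removeAt l p
    R′j-R′j′≡ = trans (proj₂ (Vecₚ.∷-injective Rx-Ry≡Ml)) (*ᵥ-removeAt rest l p lp≡0)
    j≡j′ = R′-incongruent j j′ (removeAt l p , R′j-R′j′≡)

toℕ<-≢fromℕ : ∀ {m} (j : Fin (suc m)) → j ≢ fromℕ m → toℕ j < m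
toℕ<-≢fromℕ {m} j j≢m = ℕₚ.≤∧≢⇒< (ℕₚ.<⇒≤pred (Finₚ.toℕ<n j))
                          (λ j≡m → j≢m (Finₚ.toℕ-injective (trans j≡m (sym (Finₚ.toℕ-fromℕ m)))))

incongruentFamily-det : ∀ {n} (M : Mat n) → IncongruentFamily M ∣ det M ∣
incongruentFamily-det {zero}  []  = (λ _ → []) , λ { zero zero _ → refl }
incongruentFamily-det {suc m} M
  with row ∷ rest , M⇝ , zeros ← clearPrefix m ℕₚ.≤-refl M =
  ⇝-incongruent M⇝ (subst (IncongruentFamily (row ∷ rest)) size
    (incongruent-singleEntry row rest p single (incongruentFamily-det (minor rest p))))
  where
  p = fromℕ m
  single : SingleEntry row p
  single j j≢p = zeros j (toℕ<-≢fromℕ j j≢p)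
  g = lookup row p
  D = det (minor rest p)
  size : ∣ g ∣ ℕ.* ∣ D ∣ ≡ ∣ det M ∣
  size = begin
    ∣ g ∣ ℕ.* ∣ D ∣                ≡⟨ cong (ℕ._* ∣ D ∣) (∣sgn*∣ (toℕ p) g) ⟨
    ∣ sgn (toℕ p) * g ∣ ℕ.* ∣ D ∣  ≡⟨ ℤₚ.abs-* (sgn (toℕ p) * g) D ⟨
    ∣ sgn (toℕ p) * g * D ∣        ≡⟨ cong ∣_∣ (det-singleEntry row rest p single) ⟨
    ∣ det (row ∷ rest) ∣           ≡⟨ cong ∣_∣ (_⇝_.det-≡ M⇝) ⟩
    ∣ det M ∣                      ∎
    where open ≡-Reasoning

lemma1 : (n : ℕ) → 1 ≤ n → (M : Mat n) → det M ≢ + 0 →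
         (L : List (Vec ℕ n)) → IsHyperL M L →
         (t : ℕ) → 1 ≤ t →
         (x y : Vec ℕ n) → x ∈Dilate (t , L) → y ∈Dilate (t , L) → x ≢ y →
         ¬ (toℤ x ≡ toℤ y [mod (t ·ₘ M) ])
lemma1 n _ M _ L hL t _ _ _ (a , α , a∈L , α<t , refl) (b , β , b∈L , β<t , refl) x≢y (l , x-y≡tMl)
  with α≡β , a-b≡Ml ← dilate-mod t M l α<t β<t x-y≡tMl =
  hyperL-incongruent hL (incongruentFamily-det M) a∈L b∈L a≢b (l , a-b≡Ml)
  where
  a≢b : a ≢ b
  a≢b a≡b = x≢y (cong₂ (dilate t) a≡b α≡β)
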